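{- Let $S=X_1\times\cdots\times X_n$ be a product state space, and let $\mathcal D_1=(A_1,U_1)$ and $\mathcal D_2=(A_2,U_2)$ be two decision problems on $S$ with optimizer maps $\mathrm{Opt}_1,\mathrm{Opt}_2$. Suppose they induce the same decision quotient relation, i.e. for all $s,s'\in S$, $\mathrm{Opt}_1(s)=\mathrm{Opt}_1(s')\iff \mathrm{Opt}_2(s)=\mathrm{Opt}_2(s')$. Then: (i) a coordinate set $I\subseteq\{1,\dots,n\}$ is sufficient for $\mathcal D_1$ if and only if it is sufficient for $\mathcal D_2$; (ii) $I$ is a minimal sufficient set for $\mathcal D_1$ if and only if it is one for $\mathcal D_2$; (iii) a coordinate $i$ is relevant for $\mathcal D_1$ if and only if it is relevant for $\mathcal D_2$ (equivalently, the irrelevant coordinates coincide). Moreover, there is a bijection $\beta$ from the range of $\mathrm{Opt}_1$ onto the range of $\mathrm{Opt}_2$ with $\beta(\mathrm{Opt}_1(s))=\mathrm{Opt}_2(s)$ for all $s\in S$; in particular, if $S$ is finite then $\mathcal D_1$ and $\mathcal D_2$ have the same number of distinct optimizer sets.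
   Context: A decision problem on a state space $S=X_1\times\cdots\times X_n$ consists of an action set $A$ and a utility $U:A\times S\to\mathbb R$; its optimizer map is $\mathrm{Opt}(s)=\{a\in A:\ U(a',s)\le U(a,s)\text{ for all }a'\in A\}$. The decision quotient relation is $s\sim s'\iff \mathrm{Opt}(s)=\mathrm{Opt}(s')$. For $I\subseteq\{1,\dots,n\}$, write $s_I=s'_I$ if $s_j=s'_j$ for all $j\in I$. A set $I$ is sufficient if $s_I=s'_I$ implies $\mathrm{Opt}(s)=\mathrm{Opt}(s')$ for all $s,s'\in S$; it is minimal sufficient if it is sufficient and no proper subset of it is sufficient. A coordinate $i$ is relevant if there exist $s,s'\in S$ with $s_j=s'_j$ for all $j\neq i$ and $\mathrm{Opt}(s)\neq\mathrm{Opt}(s')$; otherwise it is irrelevant. -}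

module Defs where

open import Level using (0ℓ) renaming (suc to lsuc)
open import Data.Nat using (ℕ)
open import Data.Fin using (Fin)
open import Data.Fin.Subset using (Subset; _∈_; _⊂_)
open import Data.Product using (Σ; ∃; _×_; _,_; proj₁)
open import Relation.Unary using (Pred; _≐_)
open import Relation.Unary.Properties using (≐-refl; ≐-sym; ≐-trans)
open import Relation.Binary using (TotalOrder; Setoid)
open import Relation.Binary.PropositionalEquality using (_≡_; _≢_)
open import Relation.Nullary using (¬_)
open import Function.Bundles using (_⇔_)

State : {n : ℕ} → (Fin n → Set) → Set
State {n} X = (i : Fin n) → X i

-- A decision problem (A, U) on S, utilities valued in a totally ordered type V
-- (ℝ with ≤ is the paper's instance; agda-stdlib has no reals).
record DecisionProblem (n : ℕ) (X : Fin n → Set) (V : TotalOrder 0ℓ 0ℓ 0ℓ) : Set₁ where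
  field
    A : Set
    U : A → State X → TotalOrder.Carrier V

module _ {n : ℕ} {X : Fin n → Set} {V : TotalOrder 0ℓ 0ℓ 0ℓ} where
  open TotalOrder V using (_≤_)
  open DecisionProblem

  Opt : (D : DecisionProblem n X V) → State X → Pred (A D) 0ℓ
  Opt D s a = ∀ a′ → U D a′ s ≤ U D a s

  AgreeOn : Subset n → State X → State X → Set
  AgreeOn I s s′ = ∀ j → j ∈ I → s j ≡ s′ j

  Sufficient : DecisionProblem n X V → Subset n → Set
  Sufficient D I = ∀ s s′ → AgreeOn I s s′ → Opt D s ≐ Opt D s′

  MinimalSufficient : DecisionProblem n X V → Subset n → Set
  MinimalSufficient D I = Sufficient D I × (∀ J → J ⊂ I → ¬ Sufficient D J)

  Relevant : DecisionProblem n X V → Fin n → Set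
  Relevant D i = ∃ λ s → ∃ λ s′ →
    (∀ j → j ≢ i → s j ≡ s′ j) × ¬ (Opt D s ≐ Opt D s′)

  SameQuotient : DecisionProblem n X V → DecisionProblem n X V → Set
  SameQuotient D₁ D₂ = ∀ s s′ → (Opt D₁ s ≐ Opt D₁ s′) ⇔ (Opt D₂ s ≐ Opt D₂ s′)

  Range : DecisionProblem n X V → Setoid (lsuc 0ℓ) 0ℓ
  Range D = record
    { Carrier = Σ (Pred (A D) 0ℓ) (λ P → ∃ λ s → P ≐ Opt D s)
    ; _≈_ = λ P Q → proj₁ P ≐ proj₁ Q
    ; isEquivalence = record { refl = ≐-refl ; sym = ≐-sym ; trans = ≐-trans }
    }

  rangeElem : (D : DecisionProblem n X V) → State X → Setoid.Carrier (Range D)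
  rangeElem D s = Opt D s , s , ≐-refl

{-# OPTIONS --safe #-}
module Submission where

-- Sufficiency, relevance and minimality only ever compare optimizer sets for equality,
-- so they are properties of the decision quotient relation alone.  Every element of
-- the range of Opt is represented by a state, and two representatives give equal
-- elements exactly when the states are related; so the range of Opt is the quotient
-- of S by that relation, and problems with the same quotient have isomorphic ranges.

open import Defs
open import Level using (0ℓ)
open import Data.Nat using (ℕ)
open import Data.Fin using (Fin)
open import Data.Fin.Subset using (Subset)
open import Data.Product using (Σ; _×_; _,_; proj₁; proj₂)
open import Function.Base using (_∘_)
open import Relation.Binary using (TotalOrder; Setoid)
open import Relation.Binary.PropositionalEquality using (setoid)
open import Relation.Unary using (_≐_)
open import Relation.Unary.Properties using (≐-refl; ≐-sym; ≐-trans)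
open import Function.Bundles using (_⇔_; Bijection; Equivalence; mk⇔)
open import Function.Definitions using (Congruent; Injective; StrictlySurjective)
open import Function.Consequences.Setoid using (strictlySurjective⇒surjective)
import Function.Properties.Bijection as Bijection
import Function.Properties.Equivalence as Equivalence

module _ {n : ℕ} {X : Fin n → Set} {V : TotalOrder 0ℓ 0ℓ 0ℓ} where

  QuotientRefines : DecisionProblem n X V → DecisionProblem n X V → Set
  QuotientRefines D₁ D₂ = ∀ s s′ → Opt D₁ s ≐ Opt D₁ s′ → Opt D₂ s ≐ Opt D₂ s′

  module _ (D₁ D₂ : DecisionProblem n X V) where

    SameQuotient⇒refines : SameQuotient D₁ D₂ → QuotientRefines D₁ D₂
    SameQuotient⇒refines same s s′ = Equivalence.to (same s s′)

    SameQuotient-sym : SameQuotient D₁ D₂ → SameQuotient D₂ D₁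
    SameQuotient-sym same s s′ = Equivalence.sym (same s s′)

    sufficient-transfer : QuotientRefines D₁ D₂ → ∀ {I} → Sufficient D₁ I → Sufficient D₂ I
    sufficient-transfer refines sufficient s s′ agree = refines s s′ (sufficient s s′ agree)

    relevant-transfer : QuotientRefines D₂ D₁ → ∀ {i} → Relevant D₁ i → Relevant D₂ i
    relevant-transfer refines (s , s′ , agree , differ) =
      s , s′ , agree , λ same → differ (refines s s′ same)

    minimalSufficient-transfer : (∀ J → Sufficient D₁ J ⇔ Sufficient D₂ J) →
                                 ∀ {I} → MinimalSufficient D₁ I → MinimalSufficient D₂ I
    minimalSufficient-transfer sufficient⇔ {I} (sufficient , minimal) =
        Equivalence.to (sufficient⇔ I) sufficient
      , λ J J⊂I sufficientJ → minimal J J⊂I (Equivalence.from (sufficient⇔ J) sufficientJ)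

  module _ (D : DecisionProblem n X V) where
    open Setoid (Range D) using (Carrier; _≈_)

    representative : Carrier → State X
    representative = proj₁ ∘ proj₂

    represents : (P : Carrier) → proj₁ P ≐ Opt D (representative P)
    represents = proj₂ ∘ proj₂

    representative-cong : ∀ P Q → P ≈ Q → Opt D (representative P) ≐ Opt D (representative Q)
    representative-cong P Q P≈Q = ≐-trans (≐-sym (represents P)) (≐-trans P≈Q (represents Q))

    representative-injective : ∀ P Q → Opt D (representative P) ≐ Opt D (representative Q) → P ≈ Q
    representative-injective P Q same =
      ≐-trans (represents P) (≐-trans same (≐-sym (represents Q)))

  module _ (D₁ D₂ : DecisionProblem n X V) (same : SameQuotient D₁ D₂) where

    private
      refines₁₂ : QuotientRefines D₁ D₂
      refines₁₂ = SameQuotient⇒refines D₁ D₂ same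

      refines₂₁ : QuotientRefines D₂ D₁
      refines₂₁ = SameQuotient⇒refines D₂ D₁ (SameQuotient-sym D₁ D₂ same)

    sufficient-⇔ : ∀ I → Sufficient D₁ I ⇔ Sufficient D₂ I
    sufficient-⇔ I = mk⇔
      (sufficient-transfer D₁ D₂ refines₁₂)
      (sufficient-transfer D₂ D₁ refines₂₁)

    minimalSufficient-⇔ : ∀ I → MinimalSufficient D₁ I ⇔ MinimalSufficient D₂ I
    minimalSufficient-⇔ I = mk⇔
      (minimalSufficient-transfer D₁ D₂ sufficient-⇔)
      (minimalSufficient-transfer D₂ D₁ (Equivalence.sym ∘ sufficient-⇔))

    relevant-⇔ : ∀ i → Relevant D₁ i ⇔ Relevant D₂ i
    relevant-⇔ i = mk⇔
      (relevant-transfer D₁ D₂ refines₂₁)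
      (relevant-transfer D₂ D₁ refines₁₂)

    rangeBijection : Bijection (Range D₁) (Range D₂)
    rangeBijection = record
      { to        = to
      -- Eta-expanded because P and Q cannot be inferred through proj₁ P ≐ proj₁ Q.
      ; cong      = λ {P} {Q} → cong {P} {Q}
      ; bijective = (λ {P} {Q} → injective {P} {Q})
                  , strictlySurjective⇒surjective (Range D₁) (Range D₂) {f = to}
                      (λ {P} {Q} → cong {P} {Q}) strictlySurjective
      }
      where
      open Setoid (Range D₁) using () renaming (Carrier to Range₁; _≈_ to _≈₁_)
      open Setoid (Range D₂) using () renaming (Carrier to Range₂; _≈_ to _≈₂_)

      to : Range₁ → Range₂
      to = rangeElem D₂ ∘ representative D₁

      cong : Congruent _≈₁_ _≈₂_ to
      cong {P} {Q} P≈Q =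
        refines₁₂ (representative D₁ P) (representative D₁ Q) (representative-cong D₁ P Q P≈Q)

      injective : Injective _≈₁_ _≈₂_ to
      injective {P} {Q} toP≈toQ =
        representative-injective D₁ P Q (refines₂₁ (representative D₁ P) (representative D₁ Q) toP≈toQ)

      strictlySurjective : StrictlySurjective _≈₂_ to
      strictlySurjective Q = rangeElem D₁ (representative D₂ Q) , ≐-sym (represents D₂ Q)

    rangeBijection-rangeElem : (s : State X) →
      Setoid._≈_ (Range D₂) (Bijection.to rangeBijection (rangeElem D₁ s)) (rangeElem D₂ s)
    rangeBijection-rangeElem s = ≐-refl

  rangeCount-⇔ : (D₁ D₂ : DecisionProblem n X V) → SameQuotient D₁ D₂ → ∀ k →
    Bijection (Range D₁) (setoid (Fin k)) ⇔ Bijection (Range D₂) (setoid (Fin k))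
  rangeCount-⇔ D₁ D₂ same k = mk⇔
    (Bijection.trans (rangeBijection D₂ D₁ (SameQuotient-sym D₁ D₂ same)))
    (Bijection.trans (rangeBijection D₁ D₂ same))

mainTheorem1 : {n : ℕ} {X : Fin n → Set} {V : TotalOrder 0ℓ 0ℓ 0ℓ}
    (D₁ D₂ : DecisionProblem n X V) →
    SameQuotient D₁ D₂ →
    ((I : Subset n) → Sufficient D₁ I ⇔ Sufficient D₂ I)
    × ((I : Subset n) → MinimalSufficient D₁ I ⇔ MinimalSufficient D₂ I)
    × ((i : Fin n) → Relevant D₁ i ⇔ Relevant D₂ i)
    × Σ (Bijection (Range D₁) (Range D₂))
        (λ β → (s : State X) →
          Setoid._≈_ (Range D₂) (Bijection.to β (rangeElem D₁ s)) (rangeElem D₂ s))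
    × ((k : ℕ) → Bijection (Range D₁) (setoid (Fin k)) ⇔ Bijection (Range D₂) (setoid (Fin k)))
mainTheorem1 D₁ D₂ same =
    sufficient-⇔ D₁ D₂ same
  , minimalSufficient-⇔ D₁ D₂ same
  , relevant-⇔ D₁ D₂ same
  , (rangeBijection D₁ D₂ same , rangeBijection-rangeElem D₁ D₂ same)
  , rangeCount-⇔ D₁ D₂ same
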